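{- Let $M$ be a positive integer. Then $G_0(M) = \Gamma_0(M)\, G_0(M)_{i\infty}$, where $G_0(M)_{i\infty}$ is the stabilizer of $i\infty$ in $G_0(M)$ under the action by Möbius transformations, i.e. the set of elements of $G_0(M)$ with lower-left entry $0$.
   Context: $\mathbb{Z}_{(M)} = \{a/b\in\mathbb{Q} : a,b\in\mathbb{Z},\ \gcd(b,M)=1\}$. $\mathrm{GL}_2(\mathbb{Z}_{(M)}) = \{\gamma\in M_2(\mathbb{Z}_{(M)}) : \det\gamma\in\mathbb{Z}_{(M)}^\times\}$. $G_0(M) = \{\gamma\in\mathrm{GL}_2(\mathbb{Z}_{(M)}) : \gamma\equiv\begin{pmatrix}*&*\\0&*\end{pmatrix}\bmod M\mathbb{Z}_{(M)}\}$, i.e. the lower-left entry lies in $M\mathbb{Z}_{(M)}$. $\Gamma_0(M)$ is the group of matrices in $\mathrm{SL}_2(\mathbb{Z})$ with lower-left entry divisible by $M$; note $\Gamma_0(M) = G_0(M)\cap\mathrm{SL}_2(\mathbb{Z})$. -}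

module Defs where

open import Data.Nat using (ℕ)
open import Data.Nat.Coprimality using (Coprime)
open import Data.Integer using (ℤ; +_)
open import Data.Rational using (ℚ; _+_; _*_; _-_; 0ℚ; 1ℚ; _/_)
import Data.Rational as ℚ
open import Data.Product using (Σ; _×_)
open import Relation.Binary.PropositionalEquality using (_≡_)

record Mat2 : Set where
  constructor mat
  field
    a b c d : ℚ
open Mat2 public

_·_ : Mat2 → Mat2 → Mat2
mat a₁ b₁ c₁ d₁ · mat a₂ b₂ c₂ d₂ =
  mat (a₁ * a₂ + b₁ * c₂) (a₁ * b₂ + b₁ * d₂)
      (c₁ * a₂ + d₁ * c₂) (c₁ * b₂ + d₁ * d₂)

det : Mat2 → ℚ
det (mat a b c d) = a * d - b * c

ℕtoℚ : ℕ → ℚ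
ℕtoℚ n = + n / 1

-- ℤ_(M): rationals whose reduced denominator is coprime to M
InZloc : ℕ → ℚ → Set
InZloc M q = Coprime (ℚ.denominatorℕ q) M

IsUnitZloc : ℕ → ℚ → Set
IsUnitZloc M q = Σ ℚ (λ u → InZloc M u × (q * u ≡ 1ℚ))

InM2Zloc : ℕ → Mat2 → Set
InM2Zloc M g = InZloc M (a g) × InZloc M (b g) × InZloc M (c g) × InZloc M (d g)

InGL2Zloc : ℕ → Mat2 → Set
InGL2Zloc M g = InM2Zloc M g × IsUnitZloc M (det g)

InG0 : ℕ → Mat2 → Set
InG0 M g = InGL2Zloc M g × Σ ℚ (λ x → InZloc M x × (c g ≡ ℕtoℚ M * x))

IsInt : ℚ → Set
IsInt q = ℚ.denominatorℕ q ≡ 1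

InΓ0 : ℕ → Mat2 → Set
InΓ0 M g = (IsInt (a g) × IsInt (b g) × IsInt (c g) × IsInt (d g))
         × (det g ≡ 1ℚ)
         × Σ ℤ (λ k → c g ≡ ℕtoℚ M * (k / 1))

InG0∞ : ℕ → Mat2 → Set
InG0∞ M g = InG0 M g × (c g ≡ 0ℚ)

-- Let g = (a b; c d) ∈ G₀(M). Clearing the denominator s of the first column gives integers
-- (P, Q) = s (a, c); dividing by h = gcd(P, Q) gives a primitive integer column (α, γ), which
-- Bézout completes to δ = (α Y; γ X) ∈ SL₂(ℤ). As det g is a unit, a r + c t = 1 for some
-- r, t ∈ ℤ_(M), so h (α r + γ t) = s is a unit of ℤ_(M) and h is prime to M; since c ∈ M ℤ_(M),
-- M divides Q = γ h and hence γ, i.e. δ ∈ Γ₀(M). Finally δ⁻¹ g lies in G₀(M) and its lower-left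
-- entry -γ a + α c vanishes because (α, γ) is proportional to (a, c).
module Submission where

open import Data.Maybe.Base using (just; nothing)
open import Data.Nat as ℕ using (ℕ; zero; _≤_)
import Data.Nat.Divisibility as ℕD
import Data.Nat.Properties as ℕP
open import Data.Nat.Coprimality as Coprimality using (Coprime)
open import Data.Nat.GCD as ℕGCD using (module Bézout)
open import Data.Integer as ℤ using (ℤ; +_; +0)
import Data.Integer.Properties as ℤP
import Data.Integer.Divisibility.Signed as ℤD
open import Data.Integer.GCD using (gcd-zeroʳ)
import Data.Integer.Tactic.RingSolver as ℤSolver
open import Data.Rational as ℚ using (ℚ; mkℚ; _+_; _*_; _-_; -_; 0ℚ; 1ℚ; _/_; 1/_; ↥_; ↧_; ↧ₙ_; toℚᵘ)
open import Data.Rational.Properties as ℚP using (+-*-commutativeRing)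
import Data.Rational.Unnormalised as ℚᵘ
import Data.Rational.Unnormalised.Properties as ℚᵘP
open import Data.Product using (Σ; ∃₂; _×_; _,_; proj₁; proj₂)
open import Level using (0ℓ)
open import Relation.Binary.PropositionalEquality
open import Tactic.RingSolver using (solve-∀)
import Tactic.RingSolver.Core.AlmostCommutativeRing as ACR

open import Defs

open ≡-Reasoning

ℚ-ring : ACR.AlmostCommutativeRing 0ℓ 0ℓ
ℚ-ring = ACR.fromCommutativeRing +-*-commutativeRing
  λ { (mkℚ +0 zero _) → just refl; _ → nothing }

*-cancelʳ-≡ : ∀ p q r → r ≢ 0ℚ → p * r ≡ q * r → p ≡ q
*-cancelʳ-≡ p q r r≢0 eq = begin
  p                ≡⟨ x≡x*r*r⁻¹ p ⟩
  p * r * (1/ r)   ≡⟨ cong (_* 1/ r) eq ⟩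
  q * r * (1/ r)   ≡⟨ sym (x≡x*r*r⁻¹ q) ⟩
  q                ∎
  where
  instance _ = ℚ.≢-nonZero r≢0
  x≡x*r*r⁻¹ : ∀ x → x ≡ x * r * (1/ r)
  x≡x*r*r⁻¹ x = begin
    x                ≡⟨ sym (ℚP.*-identityʳ x) ⟩
    x * 1ℚ           ≡⟨ cong (x *_) (sym (ℚP.*-inverseʳ r)) ⟩
    x * (r * 1/ r)   ≡⟨ sym (ℚP.*-assoc x r (1/ r)) ⟩
    x * r * (1/ r)   ∎

coprime-* : ∀ {m n k} → Coprime m k → Coprime n k → Coprime (m ℕ.* n) k
coprime-* m⊥k n⊥k (i∣mn , i∣k) =
  n⊥k (Coprimality.coprime-divisor (λ (j∣i , j∣m) → m⊥k (j∣m , ℕD.∣-trans j∣i i∣k)) i∣mn , i∣k)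

∣-coprime : ∀ {d n k} → d ℕD.∣ n → Coprime n k → Coprime d k
∣-coprime d∣n n⊥k (i∣d , i∣k) = n⊥k (ℕD.∣-trans i∣d d∣n , i∣k)

-- Defs writes ℕtoℚ n for ι (+ n); the two agree definitionally.
ι : ℤ → ℚ
ι i = i / 1

↥-ι : ∀ i → ↥ (ι i) ≡ i
↥-ι i = trans (sym (ℤP.*-identityʳ _)) (subst (λ g → ↥ (ι i) ℤ.* g ≡ i) (gcd-zeroʳ i) (ℚP.↥-/ i 1))

↧-ι : ∀ i → ↧ (ι i) ≡ + 1
↧-ι i = trans (sym (ℤP.*-identityʳ _)) (subst (λ g → ↧ (ι i) ℤ.* g ≡ + 1) (gcd-zeroʳ i) (ℚP.↧-/ i 1))

IsInt-ι : ∀ i → IsInt (ι i)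
IsInt-ι i = ℤP.+-injective (↧-ι i)

ι-injective : ∀ {i j} → ι i ≡ ι j → i ≡ j
ι-injective {i} {j} eq = trans (sym (↥-ι i)) (trans (cong ↥_ eq) (↥-ι j))

ι-≢0 : ∀ {n} → n ≢ 0 → ι (+ n) ≢ 0ℚ
ι-≢0 n≢0 eq = n≢0 (ℤP.+-injective (ι-injective eq))

module _ where
  open ℚᵘP using (≃-sym)
  open ℚᵘP.≃-Reasoning renaming (begin_ to begin≃_; _∎ to _∎≃)

  toℚᵘ-ι : ∀ i → toℚᵘ (ι i) ℚᵘ.≃ ℚᵘ.mkℚᵘ i 0
  toℚᵘ-ι i = ℚP.toℚᵘ-fromℚᵘ (ℚᵘ.mkℚᵘ i 0)

  ι-+ : ∀ i j → ι (i ℤ.+ j) ≡ ι i + ι j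
  ι-+ i j = ℚP.toℚᵘ-injective (begin≃
    toℚᵘ (ι (i ℤ.+ j))               ≈⟨ toℚᵘ-ι (i ℤ.+ j) ⟩
    ℚᵘ.mkℚᵘ (i ℤ.+ j) 0              ≈⟨ ℚᵘ.*≡* (identity i j) ⟩
    ℚᵘ.mkℚᵘ i 0 ℚᵘ.+ ℚᵘ.mkℚᵘ j 0     ≈⟨ ℚᵘP.+-cong (≃-sym (toℚᵘ-ι i)) (≃-sym (toℚᵘ-ι j)) ⟩
    toℚᵘ (ι i) ℚᵘ.+ toℚᵘ (ι j)       ≈⟨ ≃-sym (ℚP.toℚᵘ-homo-+ (ι i) (ι j)) ⟩
    toℚᵘ (ι i + ι j)                 ∎≃)
    where
    identity : ∀ i j → (i ℤ.+ j) ℤ.* (+ 1 ℤ.* + 1) ≡ (i ℤ.* + 1 ℤ.+ j ℤ.* + 1) ℤ.* + 1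
    identity = ℤSolver.solve-∀

  ι-* : ∀ i j → ι (i ℤ.* j) ≡ ι i * ι j
  ι-* i j = ℚP.toℚᵘ-injective (begin≃
    toℚᵘ (ι (i ℤ.* j))               ≈⟨ toℚᵘ-ι (i ℤ.* j) ⟩
    ℚᵘ.mkℚᵘ (i ℤ.* j) 0              ≈⟨ ℚᵘ.*≡* (identity i j) ⟩
    ℚᵘ.mkℚᵘ i 0 ℚᵘ.* ℚᵘ.mkℚᵘ j 0     ≈⟨ ℚᵘP.*-cong (≃-sym (toℚᵘ-ι i)) (≃-sym (toℚᵘ-ι j)) ⟩
    toℚᵘ (ι i) ℚᵘ.* toℚᵘ (ι j)       ≈⟨ ≃-sym (ℚP.toℚᵘ-homo-* (ι i) (ι j)) ⟩
    toℚᵘ (ι i * ι j)                 ∎≃)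
    where
    identity : ∀ i j → (i ℤ.* j) ℤ.* (+ 1 ℤ.* + 1) ≡ (i ℤ.* j) ℤ.* + 1
    identity = ℤSolver.solve-∀

  ι-neg : ∀ i → ι (ℤ.- i) ≡ - ι i
  ι-neg i = ℚP.toℚᵘ-injective (begin≃
    toℚᵘ (ι (ℤ.- i))         ≈⟨ toℚᵘ-ι (ℤ.- i) ⟩
    ℚᵘ.- ℚᵘ.mkℚᵘ i 0         ≈⟨ ℚᵘP.-‿cong (≃-sym (toℚᵘ-ι i)) ⟩
    ℚᵘ.- toℚᵘ (ι i)          ≈⟨ ≃-sym (ℚP.toℚᵘ-homo‿- (ι i)) ⟩
    toℚᵘ (- ι i)             ∎≃)

  *-ι-↧ : ∀ q → q * ι (↧ q) ≡ ι (↥ q)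
  *-ι-↧ q@record{} = ℚP.toℚᵘ-injective (begin≃
    toℚᵘ (q * ι (↧ q))               ≈⟨ ℚP.toℚᵘ-homo-* q (ι (↧ q)) ⟩
    toℚᵘ q ℚᵘ.* toℚᵘ (ι (↧ q))       ≈⟨ ℚᵘP.*-congˡ {toℚᵘ q} (toℚᵘ-ι (↧ q)) ⟩
    toℚᵘ q ℚᵘ.* ℚᵘ.mkℚᵘ (↧ q) 0      ≈⟨ ℚᵘ.*≡* (identity (↥ q) (↧ q)) ⟩
    ℚᵘ.mkℚᵘ (↥ q) 0                  ≈⟨ ≃-sym (toℚᵘ-ι (↥ q)) ⟩
    toℚᵘ (ι (↥ q))                   ∎≃)
    where
    identity : ∀ n d → (n ℤ.* d) ℤ.* + 1 ≡ n ℤ.* (d ℤ.* + 1)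
    identity = ℤSolver.solve-∀

ι-- : ∀ i j → ι (i ℤ.- j) ≡ ι i - ι j
ι-- i j = trans (ι-+ i (ℤ.- j)) (cong (λ x → ι i + x) (ι-neg j))

*-ι≡ι⇒↥*≡*↧ : ∀ q j i → q * ι j ≡ ι i → ↥ q ℤ.* j ≡ i ℤ.* ↧ q
*-ι≡ι⇒↥*≡*↧ q j i eq = ι-injective (begin
  ι (↥ q ℤ.* j)             ≡⟨ ι-* (↥ q) j ⟩
  ι (↥ q) * ι j             ≡⟨ cong (_* ι j) (sym (*-ι-↧ q)) ⟩
  q * ι (↧ q) * ι j         ≡⟨ swap q (ι (↧ q)) (ι j) ⟩
  q * ι j * ι (↧ q)         ≡⟨ cong (_* ι (↧ q)) eq ⟩
  ι i * ι (↧ q)             ≡⟨ sym (ι-* i (↧ q)) ⟩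
  ι (i ℤ.* ↧ q)             ∎)
  where
  swap : ∀ x y z → x * y * z ≡ x * z * y
  swap = solve-∀ ℚ-ring

i*j≡k*n⇒n∣∣i∣*∣j∣ : ∀ x y z w → x ℤ.* y ≡ z ℤ.* + w → w ℕD.∣ ℤ.∣ x ∣ ℕ.* ℤ.∣ y ∣
i*j≡k*n⇒n∣∣i∣*∣j∣ x y z w eq =
  ℕD.divides ℤ.∣ z ∣ (trans (sym (ℤP.abs-* x y)) (trans (cong ℤ.∣_∣ eq) (ℤP.abs-* z (+ w))))

IsInt⇒InZloc : ∀ {M} q → IsInt q → InZloc M q
IsInt⇒InZloc {M} _ eq = subst (λ n → Coprime n M) (sym eq) (Coprimality.1-coprimeTo M)

InZloc-ι : ∀ {M} i → InZloc M (ι i)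
InZloc-ι i = IsInt⇒InZloc (ι i) (IsInt-ι i)

InZloc-neg : ∀ {M} q → InZloc M q → InZloc M (- q)
InZloc-neg {M} q = subst (λ n → Coprime n M) (sym (ℤP.+-injective (ℚP.↧-neg q)))

↧-coprime-↥ : ∀ q → Coprime (↧ₙ q) ℤ.∣ ↥ q ∣
↧-coprime-↥ (mkℚ _ _ coprime) = Coprimality.sym (Coprimality.recompute coprime)

cleared⇒InZloc : ∀ {M v} q i → Coprime v M → q * ι (+ v) ≡ ι i → InZloc M q
cleared⇒InZloc {v = v} q i v⊥M eq =
  ∣-coprime (Coprimality.coprime-divisor (↧-coprime-↥ q) (i*j≡k*n⇒n∣∣i∣*∣j∣ (↥ q) (+ v) i (↧ₙ q) (*-ι≡ι⇒↥*≡*↧ q (+ v) i eq)))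
            v⊥M

ι-↧-* : ∀ p q → ι (+ (↧ₙ p ℕ.* ↧ₙ q)) ≡ ι (↧ p) * ι (↧ q)
ι-↧-* p q = trans (cong ι (ℤP.pos-* (↧ₙ p) (↧ₙ q))) (ι-* (↧ p) (↧ q))

*-ι-↧-* : ∀ p q → p * ι (+ (↧ₙ p ℕ.* ↧ₙ q)) ≡ ι (↥ p ℤ.* ↧ q)
*-ι-↧-* p q = begin
  p * ι (+ (↧ₙ p ℕ.* ↧ₙ q))     ≡⟨ cong (p *_) (ι-↧-* p q) ⟩
  p * (ι (↧ p) * ι (↧ q))       ≡⟨ sym (ℚP.*-assoc p (ι (↧ p)) (ι (↧ q))) ⟩
  p * ι (↧ p) * ι (↧ q)         ≡⟨ cong (_* ι (↧ q)) (*-ι-↧ p) ⟩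
  ι (↥ p) * ι (↧ q)             ≡⟨ sym (ι-* (↥ p) (↧ q)) ⟩
  ι (↥ p ℤ.* ↧ q)               ∎

InZloc-* : ∀ {M} p q → InZloc M p → InZloc M q → InZloc M (p * q)
InZloc-* p q p∈ q∈ = cleared⇒InZloc (p * q) (↥ p ℤ.* ↥ q) (coprime-* p∈ q∈) (begin
  p * q * ι (+ (↧ₙ p ℕ.* ↧ₙ q))       ≡⟨ cong (p * q *_) (ι-↧-* p q) ⟩
  p * q * (ι (↧ p) * ι (↧ q))         ≡⟨ regroup p q (ι (↧ p)) (ι (↧ q)) ⟩
  p * ι (↧ p) * (q * ι (↧ q))         ≡⟨ cong₂ _*_ (*-ι-↧ p) (*-ι-↧ q) ⟩
  ι (↥ p) * ι (↥ q)                   ≡⟨ sym (ι-* (↥ p) (↥ q)) ⟩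
  ι (↥ p ℤ.* ↥ q)                     ∎)
  where
  regroup : ∀ p q x y → p * q * (x * y) ≡ p * x * (q * y)
  regroup = solve-∀ ℚ-ring

InZloc-+ : ∀ {M} p q → InZloc M p → InZloc M q → InZloc M (p + q)
InZloc-+ p q p∈ q∈ = cleared⇒InZloc (p + q) (↥ p ℤ.* ↧ q ℤ.+ ↥ q ℤ.* ↧ p) (coprime-* p∈ q∈) (begin
  (p + q) * ι (+ (↧ₙ p ℕ.* ↧ₙ q))                 ≡⟨ cong ((p + q) *_) (ι-↧-* p q) ⟩
  (p + q) * (ι (↧ p) * ι (↧ q))                   ≡⟨ regroup p q (ι (↧ p)) (ι (↧ q)) ⟩
  p * ι (↧ p) * ι (↧ q) + q * ι (↧ q) * ι (↧ p)   ≡⟨ cong₂ (λ x y → x * ι (↧ q) + y * ι (↧ p)) (*-ι-↧ p) (*-ι-↧ q) ⟩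
  ι (↥ p) * ι (↧ q) + ι (↥ q) * ι (↧ p)           ≡⟨ sym (cong₂ _+_ (ι-* (↥ p) (↧ q)) (ι-* (↥ q) (↧ p))) ⟩
  ι (↥ p ℤ.* ↧ q) + ι (↥ q ℤ.* ↧ p)               ≡⟨ sym (ι-+ (↥ p ℤ.* ↧ q) (↥ q ℤ.* ↧ p)) ⟩
  ι (↥ p ℤ.* ↧ q ℤ.+ ↥ q ℤ.* ↧ p)                 ∎)
  where
  regroup : ∀ p q x y → (p + q) * (x * y) ≡ p * x * y + q * y * x
  regroup = solve-∀ ℚ-ring

coprime-of-unit : ∀ {M h s} q → InZloc M q → Coprime s M → q * ι (+ h) ≡ ι (+ s) → Coprime h M
coprime-of-unit {h = h} {s} q q∈ s⊥M eq =
  ∣-coprime (i*j≡k*n⇒n∣∣i∣*∣j∣ (+ s) (↧ q) (↥ q) h (sym (*-ι≡ι⇒↥*≡*↧ q (+ h) (+ s) eq)))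
            (coprime-* s⊥M q∈)

∣-of-MZloc : ∀ {M} y k → InZloc M y → ι k ≡ ι (+ M) * y → M ℕD.∣ ℤ.∣ k ∣
∣-of-MZloc {M} y k y∈ eq =
  Coprimality.coprime-divisor (Coprimality.sym y∈)
    (subst (M ℕD.∣_) (ℕP.*-comm ℤ.∣ k ∣ (↧ₙ y))
      (i*j≡k*n⇒n∣∣i∣*∣j∣ k (↧ y) (↥ y) M (sym (*-ι≡ι⇒↥*≡*↧ y (+ M) k (trans (ℚP.*-comm y (ι (+ M))) (sym eq))))))

pos-Bézout : ∀ {d m n} x y → d ℕ.+ y ℕ.* n ≡ x ℕ.* m → + d ≡ + x ℤ.* + m ℤ.- + y ℤ.* + n
pos-Bézout {d} {m} {n} x y eq = begin
  + d                                         ≡⟨ add-sub (+ d) (+ y ℤ.* + n) ⟩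
  (+ d ℤ.+ + y ℤ.* + n) ℤ.- + y ℤ.* + n       ≡⟨ cong (ℤ._- + y ℤ.* + n) cast ⟩
  + x ℤ.* + m ℤ.- + y ℤ.* + n                 ∎
  where
  add-sub : ∀ i j → i ≡ i ℤ.+ j ℤ.- j
  add-sub = ℤSolver.solve-∀
  cast : + d ℤ.+ + y ℤ.* + n ≡ + x ℤ.* + m
  cast = begin
    + d ℤ.+ + y ℤ.* + n     ≡⟨ cong (λ u → + d ℤ.+ u) (sym (ℤP.pos-* y n)) ⟩
    + d ℤ.+ + (y ℕ.* n)     ≡⟨ sym (ℤP.pos-+ d (y ℕ.* n)) ⟩
    + (d ℕ.+ y ℕ.* n)       ≡⟨ cong +_ eq ⟩
    + (x ℕ.* m)             ≡⟨ ℤP.pos-* x m ⟩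
    + x ℤ.* + m             ∎

bézout : ∀ i j → ∃₂ λ x y → + ℕGCD.gcd ℤ.∣ i ∣ ℤ.∣ j ∣ ≡ x ℤ.* i ℤ.- y ℤ.* j
bézout i j with ℤD.m∣∣m∣ {i} | ℤD.m∣∣m∣ {j} | Bézout.identity (ℕGCD.gcd-GCD ℤ.∣ i ∣ ℤ.∣ j ∣)
... | ℤD.divides σᵢ ∣i∣≡σᵢi | ℤD.divides σⱼ ∣j∣≡σⱼj | Bézout.+- x y eq =
  + x ℤ.* σᵢ , + y ℤ.* σⱼ , (begin
    _                                             ≡⟨ pos-Bézout x y eq ⟩
    + x ℤ.* + ℤ.∣ i ∣ ℤ.- + y ℤ.* + ℤ.∣ j ∣       ≡⟨ cong₂ (λ m n → + x ℤ.* m ℤ.- + y ℤ.* n) ∣i∣≡σᵢi ∣j∣≡σⱼj ⟩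
    + x ℤ.* (σᵢ ℤ.* i) ℤ.- + y ℤ.* (σⱼ ℤ.* j)     ≡⟨ regroup (+ x) σᵢ i (+ y) σⱼ j ⟩
    + x ℤ.* σᵢ ℤ.* i ℤ.- + y ℤ.* σⱼ ℤ.* j         ∎)
  where
  regroup : ∀ a b c d e f → a ℤ.* (b ℤ.* c) ℤ.- d ℤ.* (e ℤ.* f) ≡ a ℤ.* b ℤ.* c ℤ.- d ℤ.* e ℤ.* f
  regroup = ℤSolver.solve-∀
... | ℤD.divides σᵢ ∣i∣≡σᵢi | ℤD.divides σⱼ ∣j∣≡σⱼj | Bézout.-+ x y eq =
  ℤ.- (+ x ℤ.* σᵢ) , ℤ.- (+ y ℤ.* σⱼ) , (begin
    _                                             ≡⟨ pos-Bézout y x eq ⟩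
    + y ℤ.* + ℤ.∣ j ∣ ℤ.- + x ℤ.* + ℤ.∣ i ∣       ≡⟨ cong₂ (λ n m → + y ℤ.* n ℤ.- + x ℤ.* m) ∣j∣≡σⱼj ∣i∣≡σᵢi ⟩
    + y ℤ.* (σⱼ ℤ.* j) ℤ.- + x ℤ.* (σᵢ ℤ.* i)     ≡⟨ regroup (+ x) σᵢ i (+ y) σⱼ j ⟩
    ℤ.- (+ x ℤ.* σᵢ) ℤ.* i ℤ.- ℤ.- (+ y ℤ.* σⱼ) ℤ.* j ∎)
  where
  regroup : ∀ a b c d e f → d ℤ.* (e ℤ.* f) ℤ.- a ℤ.* (b ℤ.* c) ≡ ℤ.- (a ℤ.* b) ℤ.* c ℤ.- ℤ.- (d ℤ.* e) ℤ.* f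
  regroup = ℤSolver.solve-∀

mat-≡ : ∀ {a b c d a′ b′ c′ d′} → a ≡ a′ → b ≡ b′ → c ≡ c′ → d ≡ d′ → mat a b c d ≡ mat a′ b′ c′ d′
mat-≡ refl refl refl refl = refl

adj : Mat2 → Mat2
adj (mat a b c d) = mat d (- b) (- c) a

det-· : ∀ g h → det (g · h) ≡ det g * det h
det-· (mat a₁ b₁ c₁ d₁) (mat a₂ b₂ c₂ d₂) = identity a₁ b₁ c₁ d₁ a₂ b₂ c₂ d₂
  where
  identity : ∀ a₁ b₁ c₁ d₁ a₂ b₂ c₂ d₂ →
    (a₁ * a₂ + b₁ * c₂) * (c₁ * b₂ + d₁ * d₂) - (a₁ * b₂ + b₁ * d₂) * (c₁ * a₂ + d₁ * c₂)
      ≡ (a₁ * d₁ - b₁ * c₁) * (a₂ * d₂ - b₂ * c₂)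
  identity = solve-∀ ℚ-ring

det-adj : ∀ g → det (adj g) ≡ det g
det-adj (mat a b c d) = identity a b c d
  where
  identity : ∀ a b c d → d * a - (- b) * (- c) ≡ a * d - b * c
  identity = solve-∀ ℚ-ring

·-adj-· : ∀ g h → det g ≡ 1ℚ → g · (adj g · h) ≡ h
·-adj-· g@(mat a b c d) (mat x y z w) det≡1 =
  mat-≡ (upper x z) (upper y w) (lower x z) (lower y w)
  where
  scale : ∀ x → det g * x ≡ x
  scale x = trans (cong (_* x) det≡1) (ℚP.*-identityˡ x)
  upper : ∀ x z → a * (d * x + - b * z) + b * (- c * x + a * z) ≡ x
  upper x z = trans (identity a b c d x z) (scale x)
    where
    identity : ∀ a b c d x z → a * (d * x + - b * z) + b * (- c * x + a * z) ≡ (a * d - b * c) * x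
    identity = solve-∀ ℚ-ring
  lower : ∀ x z → c * (d * x + - b * z) + d * (- c * x + a * z) ≡ z
  lower x z = trans (identity a b c d x z) (scale z)
    where
    identity : ∀ a b c d x z → c * (d * x + - b * z) + d * (- c * x + a * z) ≡ (a * d - b * c) * z
    identity = solve-∀ ℚ-ring

InM2Zloc-· : ∀ {M} g h → InM2Zloc M g → InM2Zloc M h → InM2Zloc M (g · h)
InM2Zloc-· {M} (mat a₁ b₁ c₁ d₁) (mat a₂ b₂ c₂ d₂) (a₁∈ , b₁∈ , c₁∈ , d₁∈) (a₂∈ , b₂∈ , c₂∈ , d₂∈) =
  dot a₁ a₂ b₁ c₂ a₁∈ a₂∈ b₁∈ c₂∈ , dot a₁ b₂ b₁ d₂ a₁∈ b₂∈ b₁∈ d₂∈ ,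
  dot c₁ a₂ d₁ c₂ c₁∈ a₂∈ d₁∈ c₂∈ , dot c₁ b₂ d₁ d₂ c₁∈ b₂∈ d₁∈ d₂∈
  where
  dot : ∀ x y z w → InZloc M x → InZloc M y → InZloc M z → InZloc M w → InZloc M (x * y + z * w)
  dot x y z w x∈ y∈ z∈ w∈ = InZloc-+ (x * y) (z * w) (InZloc-* x y x∈ y∈) (InZloc-* z w z∈ w∈)

InM2Zloc-adj : ∀ {M} g → InM2Zloc M g → InM2Zloc M (adj g)
InM2Zloc-adj (mat a b c d) (a∈ , b∈ , c∈ , d∈) = d∈ , InZloc-neg b b∈ , InZloc-neg c c∈ , a∈

IsInt⇒InM2Zloc : ∀ {M} g → IsInt (a g) × IsInt (b g) × IsInt (c g) × IsInt (d g) → InM2Zloc M g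
IsInt⇒InM2Zloc (mat a b c d) (a∈ℤ , b∈ℤ , c∈ℤ , d∈ℤ) =
  IsInt⇒InZloc a a∈ℤ , IsInt⇒InZloc b b∈ℤ , IsInt⇒InZloc c c∈ℤ , IsInt⇒InZloc d d∈ℤ

module PrimitiveColumn {M : ℕ} {p q r t : ℚ}
  (p∈ : InZloc M p) (q∈ : InZloc M q) (r∈ : InZloc M r) (t∈ : InZloc M t)
  (unimodular : p * r + q * t ≡ 1ℚ) where

  s : ℕ
  s = ↧ₙ p ℕ.* ↧ₙ q

  P Q : ℤ
  P = ↥ p ℤ.* ↧ q
  Q = ↥ q ℤ.* ↧ p

  p*s≡P : p * ι (+ s) ≡ ι P
  p*s≡P = *-ι-↧-* p q

  q*s≡Q : q * ι (+ s) ≡ ι Q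
  q*s≡Q = trans (cong (λ n → q * ι (+ n)) (ℕP.*-comm (↧ₙ p) (↧ₙ q))) (*-ι-↧-* q p)

  h : ℕ
  h = ℕGCD.gcd ℤ.∣ P ∣ ℤ.∣ Q ∣

  h∣P : + h ℤD.∣ P
  h∣P = ℤD.∣ᵤ⇒∣ (ℕGCD.gcd[m,n]∣m ℤ.∣ P ∣ ℤ.∣ Q ∣)

  h∣Q : + h ℤD.∣ Q
  h∣Q = ℤD.∣ᵤ⇒∣ (ℕGCD.gcd[m,n]∣n ℤ.∣ P ∣ ℤ.∣ Q ∣)

  α γ : ℤ
  α = ℤD.quotient h∣P
  γ = ℤD.quotient h∣Q

  ι-P : ι P ≡ ι α * ι (+ h)
  ι-P = trans (cong ι (ℤD._∣_.equality h∣P)) (ι-* α (+ h))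

  ι-Q : ι Q ≡ ι γ * ι (+ h)
  ι-Q = trans (cong ι (ℤD._∣_.equality h∣Q)) (ι-* γ (+ h))

  -- h is invertible in ℤ_(M), with inverse w / s; hence h is prime to M.
  w : ℚ
  w = ι α * r + ι γ * t

  w*h≡s : w * ι (+ h) ≡ ι (+ s)
  w*h≡s = begin
    (ι α * r + ι γ * t) * ι (+ h)                 ≡⟨ regroup (ι α) r (ι γ) t (ι (+ h)) ⟩
    ι α * ι (+ h) * r + ι γ * ι (+ h) * t         ≡⟨ cong₂ (λ x y → x * r + y * t) (sym ι-P) (sym ι-Q) ⟩
    ι P * r + ι Q * t                             ≡⟨ cong₂ (λ x y → x * r + y * t) (sym p*s≡P) (sym q*s≡Q) ⟩
    p * ι (+ s) * r + q * ι (+ s) * t             ≡⟨ factor p (ι (+ s)) r q t ⟩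
    (p * r + q * t) * ι (+ s)                     ≡⟨ cong (_* ι (+ s)) unimodular ⟩
    1ℚ * ι (+ s)                                  ≡⟨ ℚP.*-identityˡ (ι (+ s)) ⟩
    ι (+ s)                                       ∎
    where
    regroup : ∀ x r y t z → (x * r + y * t) * z ≡ x * z * r + y * z * t
    regroup = solve-∀ ℚ-ring
    factor : ∀ p x r q t → p * x * r + q * x * t ≡ (p * r + q * t) * x
    factor = solve-∀ ℚ-ring

  h-coprime : Coprime h M
  h-coprime = coprime-of-unit w (InZloc-+ (ι α * r) (ι γ * t) (InZloc-* (ι α) r (InZloc-ι α) r∈)
                                                              (InZloc-* (ι γ) t (InZloc-ι γ) t∈))
                              (coprime-* p∈ q∈) w*h≡s

  s≢0 : s ≢ 0
  s≢0 ()

  h≢0 : h ≢ 0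
  h≢0 h≡0 = ι-≢0 s≢0 (begin
    ι (+ s)           ≡⟨ sym w*h≡s ⟩
    w * ι (+ h)       ≡⟨ cong (λ n → w * ι (+ n)) h≡0 ⟩
    w * 0ℚ            ≡⟨ ℚP.*-zeroʳ w ⟩
    0ℚ                ∎)

  X Y : ℤ
  X = proj₁ (bézout P Q)
  Y = proj₁ (proj₂ (bézout P Q))

  αX-Yγ≡1 : α ℤ.* X ℤ.- Y ℤ.* γ ≡ + 1
  αX-Yγ≡1 = ℤP.*-cancelʳ-≡ _ (+ 1) (+ h) {{ℕ.≢-nonZero h≢0}} (begin
    (α ℤ.* X ℤ.- Y ℤ.* γ) ℤ.* + h             ≡⟨ regroup α X Y γ (+ h) ⟩
    X ℤ.* (α ℤ.* + h) ℤ.- Y ℤ.* (γ ℤ.* + h)   ≡⟨ cong₂ (λ i j → X ℤ.* i ℤ.- Y ℤ.* j) (sym (ℤD._∣_.equality h∣P))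
                                                                                (sym (ℤD._∣_.equality h∣Q)) ⟩
    X ℤ.* P ℤ.- Y ℤ.* Q                       ≡⟨ sym (proj₂ (proj₂ (bézout P Q))) ⟩
    + h                                       ≡⟨ sym (ℤP.*-identityˡ (+ h)) ⟩
    + 1 ℤ.* + h                               ∎)
    where
    regroup : ∀ α X Y γ h → (α ℤ.* X ℤ.- Y ℤ.* γ) ℤ.* h ≡ X ℤ.* (α ℤ.* h) ℤ.- Y ℤ.* (γ ℤ.* h)
    regroup = ℤSolver.solve-∀

  γ*p≡α*q : ι γ * p ≡ ι α * q
  γ*p≡α*q = *-cancelʳ-≡ _ _ (ι (+ h)) (ι-≢0 h≢0) (*-cancelʳ-≡ _ _ (ι (+ s)) (ι-≢0 s≢0) (begin
    ι γ * p * ι (+ h) * ι (+ s)          ≡⟨ regroup (ι γ) p (ι (+ h)) (ι (+ s)) ⟩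
    ι γ * ι (+ h) * (p * ι (+ s))        ≡⟨ cong₂ _*_ (sym ι-Q) p*s≡P ⟩
    ι Q * ι P                            ≡⟨ ℚP.*-comm (ι Q) (ι P) ⟩
    ι P * ι Q                            ≡⟨ cong₂ _*_ ι-P (sym q*s≡Q) ⟩
    ι α * ι (+ h) * (q * ι (+ s))        ≡⟨ sym (regroup (ι α) q (ι (+ h)) (ι (+ s))) ⟩
    ι α * q * ι (+ h) * ι (+ s)          ∎))
    where
    regroup : ∀ x p y z → x * p * y * z ≡ x * y * (p * z)
    regroup = solve-∀ ℚ-ring

  δ : Mat2
  δ = mat (ι α) (ι Y) (ι γ) (ι X)

  δ-integral : IsInt (a δ) × IsInt (b δ) × IsInt (c δ) × IsInt (d δ)
  δ-integral = IsInt-ι α , IsInt-ι Y , IsInt-ι γ , IsInt-ι X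

  det-δ : det δ ≡ 1ℚ
  det-δ = begin
    ι α * ι X - ι Y * ι γ             ≡⟨ sym (cong₂ _-_ (ι-* α X) (ι-* Y γ)) ⟩
    ι (α ℤ.* X) - ι (Y ℤ.* γ)         ≡⟨ sym (ι-- (α ℤ.* X) (Y ℤ.* γ)) ⟩
    ι (α ℤ.* X ℤ.- Y ℤ.* γ)           ≡⟨ cong ι αX-Yγ≡1 ⟩
    1ℚ                                ∎

  adj-δ-annihilates : - ι γ * p + ι α * q ≡ 0ℚ
  adj-δ-annihilates = begin
    - ι γ * p + ι α * q     ≡⟨ cong (λ x → - ι γ * p + x) (sym γ*p≡α*q) ⟩
    - ι γ * p + ι γ * p     ≡⟨ cong (_+ ι γ * p) (ℚP.neg-distribˡ-* (ι γ) p) ⟨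
    - (ι γ * p) + ι γ * p   ≡⟨ ℚP.+-inverseˡ (ι γ * p) ⟩
    0ℚ                      ∎

  γ∈Mℤ : ∀ x → InZloc M x → q ≡ ι (+ M) * x → Σ ℤ λ k → ι γ ≡ ι (+ M) * ι k
  γ∈Mℤ x x∈ q≡Mx = k , (begin
    ι γ                   ≡⟨ cong ι γ≡kM ⟩
    ι (k ℤ.* + M)         ≡⟨ ι-* k (+ M) ⟩
    ι k * ι (+ M)         ≡⟨ ℚP.*-comm (ι k) (ι (+ M)) ⟩
    ι (+ M) * ι k         ∎)
    where
    M∣Q : M ℕD.∣ ℤ.∣ Q ∣
    M∣Q = ∣-of-MZloc (x * ι (+ s)) Q (InZloc-* x (ι (+ s)) x∈ (InZloc-ι (+ s))) (begin
      ι Q                     ≡⟨ sym q*s≡Q ⟩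
      q * ι (+ s)             ≡⟨ cong (_* ι (+ s)) q≡Mx ⟩
      ι (+ M) * x * ι (+ s)   ≡⟨ ℚP.*-assoc (ι (+ M)) x (ι (+ s)) ⟩
      ι (+ M) * (x * ι (+ s)) ∎)
    ∣Q∣≡h*∣γ∣ : ℤ.∣ Q ∣ ≡ h ℕ.* ℤ.∣ γ ∣
    ∣Q∣≡h*∣γ∣ = trans (cong ℤ.∣_∣ (ℤD._∣_.equality h∣Q)) (trans (ℤP.abs-* γ (+ h)) (ℕP.*-comm ℤ.∣ γ ∣ h))
    M∣γ : + M ℤD.∣ γ
    M∣γ = ℤD.∣ᵤ⇒∣ (Coprimality.coprime-divisor (Coprimality.sym h-coprime) (subst (M ℕD.∣_) ∣Q∣≡h*∣γ∣ M∣Q))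
    k : ℤ
    k = ℤD.quotient M∣γ
    γ≡kM : γ ≡ k ℤ.* + M
    γ≡kM = ℤD._∣_.equality M∣γ

G0⊆Γ0·G0∞ : ∀ {M} g → InG0 M g → Σ Mat2 λ δ → Σ Mat2 λ β → InΓ0 M δ × InG0∞ M β × (g ≡ δ · β)
G0⊆Γ0·G0∞ {M} g@(mat a b c d) ((g∈M₂@(a∈ , b∈ , c∈ , d∈) , u , u∈ , det*u≡1) , x , x∈ , c≡Mx) =
  δ , adj δ · g , (δ-integral , det-δ , γ∈Mℤ x x∈ c≡Mx) , β∈G0∞ , sym (·-adj-· δ g det-δ)
  where
  unimodular : a * (d * u) + c * - (b * u) ≡ 1ℚ
  unimodular = trans (identity a b c d u) det*u≡1
    where
    identity : ∀ a b c d u → a * (d * u) + c * - (b * u) ≡ (a * d - b * c) * u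
    identity = solve-∀ ℚ-ring

  open PrimitiveColumn {M} {a} {c} {d * u} { - (b * u)}
    a∈ c∈ (InZloc-* d u d∈ u∈) (InZloc-neg (b * u) (InZloc-* b u b∈ u∈)) unimodular

  det-β : det (adj δ · g) ≡ det g
  det-β = begin
    det (adj δ · g)         ≡⟨ det-· (adj δ) g ⟩
    det (adj δ) * det g     ≡⟨ cong (_* det g) (trans (det-adj δ) det-δ) ⟩
    1ℚ * det g              ≡⟨ ℚP.*-identityˡ (det g) ⟩
    det g                   ∎

  β∈G0∞ : InG0∞ M (adj δ · g)
  β∈G0∞ =
    ( ( InM2Zloc-· (adj δ) g (InM2Zloc-adj δ (IsInt⇒InM2Zloc δ δ-integral)) g∈M₂
      , u , u∈ , trans (cong (_* u) det-β) det*u≡1)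
    , 0ℚ , InZloc-ι (+ 0) , trans adj-δ-annihilates (sym (ℚP.*-zeroʳ (ι (+ M)))))
    , adj-δ-annihilates

Γ0·G0∞⊆G0 : ∀ {M} δ β → InΓ0 M δ → InG0∞ M β → InG0 M (δ · β)
Γ0·G0∞⊆G0 {M} δ@(mat a₁ b₁ c₁ d₁) β@(mat a₂ b₂ c₂ d₂) (δ-integral , det-δ , k , c₁≡Mk)
          (((β∈M₂ , u , u∈ , det*u≡1) , _) , c₂≡0) =
  (InM2Zloc-· δ β (IsInt⇒InM2Zloc δ δ-integral) β∈M₂ , u , u∈ , trans (cong (_* u) det-δβ) det*u≡1) ,
  ι k * a₂ , InZloc-* (ι k) a₂ (InZloc-ι k) (proj₁ β∈M₂) , lower-left
  where
  det-δβ : det (δ · β) ≡ det β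
  det-δβ = trans (det-· δ β) (trans (cong (_* det β) det-δ) (ℚP.*-identityˡ (det β)))

  lower-left : c₁ * a₂ + d₁ * c₂ ≡ ι (+ M) * (ι k * a₂)
  lower-left = begin
    c₁ * a₂ + d₁ * c₂              ≡⟨ cong₂ (λ x y → x * a₂ + d₁ * y) c₁≡Mk c₂≡0 ⟩
    ι (+ M) * ι k * a₂ + d₁ * 0ℚ   ≡⟨ identity (ι (+ M)) (ι k) a₂ d₁ ⟩
    ι (+ M) * (ι k * a₂)           ∎
    where
    identity : ∀ m k a d → m * k * a + d * 0ℚ ≡ m * (k * a)
    identity = solve-∀ ℚ-ring

proposition3p2 : (M : ℕ) → 1 ≤ M →
    ((g : Mat2) → InG0 M g →
      Σ Mat2 (λ δ → Σ Mat2 (λ β → InΓ0 M δ × InG0∞ M β × (g ≡ δ · β))))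
    × ((δ β : Mat2) → InΓ0 M δ → InG0∞ M β → InG0 M (δ · β))
proposition3p2 M _ = G0⊆Γ0·G0∞ , Γ0·G0∞⊆G0
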